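{- For any strategies $\sigma : A \stackrel{S}{\to} B$, $\tau : B \stackrel{T}{\to} C$ and symmetry classes $\mathsf{x}_A, \mathsf{x}_B, \mathsf{x}_C$ of $A$, $B$, $C$, \begin{eqnarray*} |W_\sigma(\mathsf{x}_A, \mathsf{x}_B)| &=& |\mathrm{Sym}^-(\underline{\mathsf{x}}_A)| \times |\mathsf{wit}^+_\sigma(\mathsf{x}_A, \mathsf{x}_B)| \times |\mathrm{Sym}^+(\underline{\mathsf{x}}_B)|\\ |I_{\tau\circledast\sigma}(\mathsf{x}_A, \mathsf{x}_B, \mathsf{x}_C)| &=& |\mathrm{Sym}^-(\underline{\mathsf{x}}_A)| \times |J_{\tau\circledast\sigma}(\mathsf{x}_A, \mathsf{x}_B, \mathsf{x}_C)| \times |\mathrm{Sym}^+(\underline{\mathsf{x}}_C)| \end{eqnarray*}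
   Context: Thin concurrent games with symmetry $\cong$ and positive/negative sub-symmetries $\cong^\pm$; $\sigma : A\stackrel{S}{\to} B$ means a $\sim$-strategy $\sigma : S\to A^\perp\parallel B$ with $\sigma x^S = x^S_A\parallel x^S_B$; $\mathscr{C}^+(S)$ is the set of $+$-covered configurations (all maximal events positive). For each symmetry class $\mathsf{x}$ a representative $\underline{\mathsf{x}}\in\mathsf{x}$ is fixed; $\mathrm{Sym}^+(x)$ and $\mathrm{Sym}^-(x)$ are the groups of positive and negative endosymmetries of $x$. Definitions: $\mathsf{wit}^+_\sigma(\mathsf{x}_A,\mathsf{x}_B) = \{x^S\in\mathscr{C}^+(S) \mid x^S_A\cong_A^-\underline{\mathsf{x}}_A ~\&~ x^S_B \cong_B^+ \underline{\mathsf{x}}_B\}$; $W_\sigma(\mathsf{x}_A,\mathsf{x}_B)$ is the set of triples $(\theta^A_-, x^S, \theta^B_+)$ with $x^S\in\mathscr{C}^+(S)$, $\theta^A_- : x^S_A\cong_A^-\underline{\mathsf{x}}_A$, $\theta^B_+ : x^S_B\cong_B^+\underline{\mathsf{x}}_B$; $J_{\tau\circledast\sigma}(\mathsf{x}_A,\mathsf{x}_B,\mathsf{x}_C)$ is the set of $+$-covered configurations $x^T\circledast x^S$ of the interaction $T\circledast S$ (pairs matching on $B$, causally compatible) with $x^S_A\cong_A^-\underline{\mathsf{x}}_A$, $x^S_B = x^T_B\cong_B\underline{\mathsf{x}}_B$, $x^T_C\cong_C^+\underline{\mathsf{x}}_C$; $I_{\tau\circledast\sigma}(\mathsf{x}_A,\mathsf{x}_B,\mathsf{x}_C)$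 is the set of triples $(\theta^A_-, x^T\circledast x^S, \theta^C_+)$ with $x^T\circledast x^S \in J_{\tau\circledast\sigma}(\mathsf{x}_A,\mathsf{x}_B,\mathsf{x}_C)$, $\theta^A_- : x^S_A\cong_A^-\underline{\mathsf{x}}_A$, $\theta^C_+ : x^T_C \cong_C^+\underline{\mathsf{x}}_C$. $|\cdot|$ is cardinality in $\mathbb{N}\cup\{+\infty\}$. -}

module Defs where

open import Level using (0ℓ) renaming (suc to lsuc)
open import Data.Nat using (ℕ; zero; suc; _*_)
open import Data.Fin using (Fin)
open import Data.Maybe using (Maybe; just; nothing)
open import Data.List using (List)
import Data.List.Membership.Propositional as LMem
open import Data.Product using (Σ; ∃; _×_; _,_; proj₁; proj₂; ∃-syntax; Σ-syntax)
open import Data.Sum using (_⊎_; inj₁; inj₂)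
open import Data.Empty using (⊥)
open import Data.Unit using (⊤)
open import Relation.Nullary using (¬_)
open import Relation.Binary.PropositionalEquality using (_≡_; refl)
import Relation.Binary.PropositionalEquality as PE
open import Relation.Binary.Bundles using (Setoid)
import Relation.Binary.Construct.On as On
open import Relation.Binary.Construct.Closure.Transitive using (TransClosure)
open import Data.Product.Relation.Binary.Pointwise.NonDependent using (_×ₛ_)
open import Function.Bundles using (Inverse; Injection)

-- Subsets and binary relations (bijections are given by their graphs)

Sub : Set → Set₁
Sub E = E → Set

BRel : Set → Set₁
BRel E = E → E → Set

module _ {E : Set} where

  _⊆ₛ_ : Sub E → Sub E → Set
  X ⊆ₛ Y = ∀ {e} → X e → Y e

  _≐ₛ_ : Sub E → Sub E → Set
  X ≐ₛ Y = X ⊆ₛ Y × Y ⊆ₛ X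

  addEv : Sub E → E → Sub E
  addEv X g e = X e ⊎ e ≡ g

  _⊆ᵣ_ : BRel E → BRel E → Set
  θ ⊆ᵣ ψ = ∀ {e e'} → θ e e' → ψ e e'

  _≐ᵣ_ : BRel E → BRel E → Set
  θ ≐ᵣ ψ = θ ⊆ᵣ ψ × ψ ⊆ᵣ θ

  idRel : Sub E → BRel E
  idRel X e e' = X e × e ≡ e'

  invRel : BRel E → BRel E
  invRel θ e e' = θ e' e

  _⨾_ : BRel E → BRel E → BRel E
  (θ ⨾ ψ) e e'' = ∃[ e' ] (θ e e' × ψ e' e'')

  restrictRel : Sub E → BRel E → BRel E
  restrictRel X' θ e e' = X' e × θ e e'

  IsIdentity : BRel E → Set
  IsIdentity θ = ∀ {e e'} → θ e e' → e ≡ e'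

  record Bij (θ : BRel E) (X Y : Sub E) : Set where
    field
      dom : ∀ {e e'} → θ e e' → X e
      cod : ∀ {e e'} → θ e e' → Y e'
      tot : ∀ {e} → X e → ∃[ e' ] θ e e'
      sur : ∀ {e'} → Y e' → ∃[ e ] θ e e'
      fun : ∀ {e e₁ e₂} → θ e e₁ → θ e e₂ → e₁ ≡ e₂
      inj : ∀ {e₁ e₂ e'} → θ e₁ e' → θ e₂ e' → e₁ ≡ e₂

  Finite : Sub E → Set
  Finite X = Σ[ l ∈ List E ] (∀ e → (X e → e LMem.∈ l) × (e LMem.∈ l → X e))

data Pol : Set where
  pos neg : Pol

dualPol : Pol → Pol
dualPol pos = neg
dualPol neg = pos

module OnES {E : Set} (_≤_ _#_ : BRel E) where

  _<_ : BRel E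
  e < e' = e ≤ e' × ¬ (e ≡ e')

  _⋖_ : BRel E
  e ⋖ e' = e < e' × (∀ e'' → e < e'' → e'' < e' → ⊥)

  record IsES : Set where
    field
      ≤-refl    : ∀ {e} → e ≤ e
      ≤-trans   : ∀ {e e' e''} → e ≤ e' → e' ≤ e'' → e ≤ e''
      ≤-antisym : ∀ {e e'} → e ≤ e' → e' ≤ e → e ≡ e'
      ≤-finite  : ∀ e → Finite (λ e' → e' ≤ e)
      #-irrefl  : ∀ {e} → ¬ (e # e)
      #-sym     : ∀ {e e'} → e # e' → e' # e
      #-her     : ∀ {e e' e''} → e # e' → e' ≤ e'' → e # e''

  record IsConfig (X : Sub E) : Set where
    field
      finite   : Finite X
      downward : ∀ {e e'} → e' ≤ e → X e → X e'
      cfree    : ∀ {e e'} → X e → X e' → ¬ (e # e')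

  record IsIsoFam (𝒮 : BRel E → Set) : Set₁ where
    field
      isBij       : ∀ {θ} → 𝒮 θ →
                    Σ[ X ∈ Sub E ] Σ[ Y ∈ Sub E ] (IsConfig X × IsConfig Y × Bij θ X Y)
      extensional : ∀ {θ ψ} → θ ≐ᵣ ψ → 𝒮 θ → 𝒮 ψ
      identity    : ∀ {X} → IsConfig X → 𝒮 (idRel X)
      inverse     : ∀ {θ} → 𝒮 θ → 𝒮 (invRel θ)
      composition : ∀ {θ ψ X Y Z} → 𝒮 θ → 𝒮 ψ → Bij θ X Y → Bij ψ Y Z → 𝒮 (θ ⨾ ψ)
      restriction : ∀ {θ X Y X'} → 𝒮 θ → Bij θ X Y → IsConfig X' → X' ⊆ₛ X →
                    𝒮 (restrictRel X' θ)
      extension   : ∀ {θ X Y X'} → 𝒮 θ → Bij θ X Y → IsConfig X' → X ⊆ₛ X' →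
                    Σ[ θ' ∈ BRel E ] Σ[ Y' ∈ Sub E ] (𝒮 θ' × Bij θ' X' Y' × θ ⊆ᵣ θ')

  ExtBy : (E → Pol) → Pol → BRel E → BRel E → Set
  ExtBy pol p θ θ' = θ ⊆ᵣ θ' × (∀ {e e'} → θ' e e' → ¬ θ e e' → pol e ≡ p)

  PlusCovered : (E → Pol) → Sub E → Set
  PlusCovered pol X = ∀ e → X e → (∀ e' → X e' → ¬ (e < e')) → pol e ≡ pos

record ESS : Set₁ where
  field
    E   : Set
    _≤_ : BRel E
    _#_ : BRel E
    pol : E → Pol
    Sym : BRel E → Set
  open OnES _≤_ _#_ public

record IsESS (S : ESS) : Set₁ where
  open ESS S
  field
    isES      : IsES
    symIsoFam : IsIsoFam Sym
    symPol    : ∀ {θ e e'} → Sym θ → θ e e' → pol e ≡ pol e'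

record Game : Set₁ where
  field
    ess  : ESS
    Sym⁻ : BRel (ESS.E ess) → Set
    Sym⁺ : BRel (ESS.E ess) → Set
  open ESS ess public

record IsTCG (A : Game) : Set₁ where
  open Game A
  field
    isESS       : IsESS ess
    sym⁻IsoFam  : IsIsoFam Sym⁻
    sym⁺IsoFam  : IsIsoFam Sym⁺
    sym⁻⊆sym    : ∀ {θ} → Sym⁻ θ → Sym θ
    sym⁺⊆sym    : ∀ {θ} → Sym⁺ θ → Sym θ
    sym⁻∩sym⁺   : ∀ {θ} → Sym⁻ θ → Sym⁺ θ → IsIdentity θ
    ext⁻        : ∀ {θ θ'} → Sym⁻ θ → ExtBy pol neg θ θ' → Sym θ' → Sym⁻ θ'
    ext⁺        : ∀ {θ θ'} → Sym⁺ θ → ExtBy pol pos θ θ' → Sym θ' → Sym⁺ θ'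
    thin        : ∀ {X θ} → IsConfig X → ExtBy pol pos (idRel X) θ → Sym⁻ θ → IsIdentity θ

dual : Game → Game
dual A = record
  { ess  = record { E = E ; _≤_ = _≤_ ; _#_ = _#_ ; pol = λ a → dualPol (pol a) ; Sym = Sym }
  ; Sym⁻ = Sym⁺
  ; Sym⁺ = Sym⁻ }
  where open Game A

module _ {X Y : Set} where

  _⊎ᴿ_ : BRel X → BRel Y → BRel (X ⊎ Y)
  (R ⊎ᴿ S) (inj₁ a) (inj₁ a') = R a a'
  (R ⊎ᴿ S) (inj₂ b) (inj₂ b') = S b b'
  (R ⊎ᴿ S) _ _ = ⊥

  leftPart : BRel (X ⊎ Y) → BRel X
  leftPart θ a a' = θ (inj₁ a) (inj₁ a')

  rightPart : BRel (X ⊎ Y) → BRel Y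
  rightPart θ b b' = θ (inj₂ b) (inj₂ b')

  SameSide : X ⊎ Y → X ⊎ Y → Set
  SameSide (inj₁ _) (inj₁ _) = ⊤
  SameSide (inj₂ _) (inj₂ _) = ⊤
  SameSide _ _ = ⊥

  parSym : (BRel X → Set) → (BRel Y → Set) → BRel (X ⊎ Y) → Set
  parSym 𝒮X 𝒮Y θ = (∀ {u v} → θ u v → SameSide u v) × 𝒮X (leftPart θ) × 𝒮Y (rightPart θ)

  parPol : (X → Pol) → (Y → Pol) → X ⊎ Y → Pol
  parPol p q (inj₁ a) = p a
  parPol p q (inj₂ b) = q b

_∥_ : Game → Game → Game
A ∥ B = record
  { ess  = record { E = A.E ⊎ B.E ; _≤_ = A._≤_ ⊎ᴿ B._≤_ ; _#_ = A._#_ ⊎ᴿ B._#_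
                  ; pol = parPol A.pol B.pol ; Sym = parSym A.Sym B.Sym }
  ; Sym⁻ = parSym A.Sym⁻ B.Sym⁻
  ; Sym⁺ = parSym A.Sym⁺ B.Sym⁺ }
  where module A = Game A
        module B = Game B

module _ {S : Set} {G : Set} where

  image : (S → G) → Sub S → Sub G
  image f X g = ∃[ s ] (X s × f s ≡ g)

  imageRel : (S → G) → BRel S → BRel G
  imageRel f θ g g' = ∃[ s ] ∃[ s' ] (θ s s' × f s ≡ g × f s' ≡ g')

record IsStrategy (S : ESS) (G : Game) (σ : ESS.E S → Game.E G) : Set₁ where
  module S = ESS S
  module G = Game G
  field
    isESS       : IsESS S
    mapConfig   : ∀ {X} → S.IsConfig X → G.IsConfig (image σ X)
    locInj      : ∀ {X} → S.IsConfig X → ∀ {s s'} → X s → X s' → σ s ≡ σ s' → s ≡ s'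
    polPres     : ∀ s → G.pol (σ s) ≡ S.pol s
    symPres     : ∀ {θ} → S.Sym θ → G.Sym (imageRel σ θ)
    courteous   : ∀ {s s'} → s S.⋖ s' → (S.pol s ≡ pos ⊎ S.pol s' ≡ neg) → σ s G.⋖ σ s'
    receptive   : ∀ {X g} → S.IsConfig X → G.IsConfig (addEv (image σ X) g) →
                  ¬ image σ X g → G.pol g ≡ neg →
                  Σ[ s ∈ S.E ] ((¬ X s × S.IsConfig (addEv X s) × σ s ≡ g) ×
                     (∀ s' → ¬ X s' → S.IsConfig (addEv X s') → σ s' ≡ g → s' ≡ s))
    ~-receptive : ∀ {θ ψ} → S.Sym θ → G.Sym ψ → G.ExtBy G.pol neg (imageRel σ θ) ψ →
                  Σ[ θ' ∈ BRel S.E ] ((S.Sym θ' × θ ⊆ᵣ θ' × imageRel σ θ' ≐ᵣ ψ) ×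
                     (∀ θ'' → S.Sym θ'' → θ ⊆ᵣ θ'' → imageRel σ θ'' ≐ᵣ ψ → θ'' ≐ᵣ θ'))
    thin        : ∀ {X θ} → S.IsConfig X → S.Sym θ → S.ExtBy S.pol pos (idRel X) θ → IsIdentity θ

record Strategy (A B : Game) : Set₁ where
  field
    S       : ESS
    σ       : ESS.E S → Game.E (dual A ∥ B)
    isStrat : IsStrategy S (dual A ∥ B) σ
  open ESS S public

data ℕ∞ : Set where
  fin : ℕ → ℕ∞
  ∞   : ℕ∞

_*∞_ : ℕ∞ → ℕ∞ → ℕ∞
fin m       *∞ fin n       = fin (m * n)
fin zero    *∞ ∞           = fin 0
fin (suc _) *∞ ∞           = ∞
∞           *∞ fin zero    = fin 0
∞           *∞ fin (suc _) = ∞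
∞           *∞ ∞           = ∞

HasCard : ∀ {c ℓ} → Setoid c ℓ → ℕ∞ → Set _
HasCard X (fin n) = Inverse X (PE.setoid (Fin n))
HasCard X ∞       = Injection (PE.setoid ℕ) X

SubSetoid : Set → Setoid (lsuc 0ℓ) 0ℓ
SubSetoid E = record
  { Carrier = Sub E ; _≈_ = _≐ₛ_
  ; isEquivalence = record
    { refl = (λ x → x) , (λ x → x)
    ; sym = λ (p , q) → q , p
    ; trans = λ (p , q) (p' , q') → (λ x → p' (p x)) , (λ x → q (q' x)) } }

RelSetoid : Set → Setoid (lsuc 0ℓ) 0ℓ
RelSetoid E = record
  { Carrier = BRel E ; _≈_ = _≐ᵣ_
  ; isEquivalence = record
    { refl = (λ x → x) , (λ x → x)
    ; sym = λ (p , q) → q , p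
    ; trans = λ (p , q) (p' , q') → (λ x → p' (p x)) , (λ x → q (q' x)) } }

SymMinus : (A : Game) → Sub (Game.E A) → Setoid (lsuc 0ℓ) 0ℓ
SymMinus A x = On.setoid (RelSetoid (Game.E A))
  (proj₁ {B = λ θ → Game.Sym⁻ A θ × Bij θ x x})

SymPlus : (A : Game) → Sub (Game.E A) → Setoid (lsuc 0ℓ) 0ℓ
SymPlus A x = On.setoid (RelSetoid (Game.E A))
  (proj₁ {B = λ θ → Game.Sym⁺ A θ × Bij θ x x})

module StratProj {A B : Game} (str : Strategy A B) where
  open Strategy str
  projA : Sub E → Sub (Game.E A)
  projA x a = ∃[ s ] (x s × σ s ≡ inj₁ a)
  projB : Sub E → Sub (Game.E B)
  projB x b = ∃[ s ] (x s × σ s ≡ inj₂ b)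

module _ {A B : Game} (str : Strategy A B) (rA : Sub (Game.E A)) (rB : Sub (Game.E B)) where
  open Strategy str
  open StratProj str
  private
    module A = Game A
    module B = Game B

  -- the property defining wit⁺_σ(x_A, x_B) (witnessing symmetries included as data)
  WitProp : Sub E → Set₁
  WitProp x = IsConfig x × PlusCovered pol x ×
              (Σ[ θ ∈ BRel A.E ] (A.Sym⁻ θ × Bij θ (projA x) rA)) ×
              (Σ[ θ ∈ BRel B.E ] (B.Sym⁺ θ × Bij θ (projB x) rB))

  Wit : Setoid (lsuc 0ℓ) 0ℓ
  Wit = On.setoid (SubSetoid E) (proj₁ {B = WitProp})

  WTriple : Set₁
  WTriple = Σ[ θA ∈ BRel A.E ] Σ[ x ∈ Sub E ] Σ[ θB ∈ BRel B.E ]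
              ((IsConfig x × PlusCovered pol x) ×
               (A.Sym⁻ θA × Bij θA (projA x) rA) × (B.Sym⁺ θB × Bij θB (projB x) rB))

  WSet : Setoid (lsuc 0ℓ) 0ℓ
  WSet = On.setoid (RelSetoid A.E ×ₛ (SubSetoid E ×ₛ RelSetoid B.E))
    (λ (w : WTriple) → proj₁ w , proj₁ (proj₂ w) , proj₁ (proj₂ (proj₂ w)))

-- events of the interaction: synchronised pairs on B, or unsynchronised events on A / C
data IEv (SE TE : Set) : Set where
  ievA : SE → IEv SE TE
  ievB : SE → TE → IEv SE TE
  ievC : TE → IEv SE TE

module Interaction {A B C : Game} (σ : Strategy A B) (τ : Strategy B C) where
  private
    module A = Game A
    module B = Game B
    module C = Game C
    module σ = Strategy σ
    module τ = Strategy τ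

  open StratProj σ public using () renaming (projA to projSA; projB to projSB)
  open StratProj τ public using () renaming (projA to projTB; projB to projTC)

  projS : IEv σ.E τ.E → Maybe σ.E
  projS (ievA s)   = just s
  projS (ievB s t) = just s
  projS (ievC t)   = nothing

  projT : IEv σ.E τ.E → Maybe τ.E
  projT (ievA s)   = nothing
  projT (ievB s t) = just t
  projT (ievC t)   = just t

  InI : Sub σ.E → Sub τ.E → Sub (IEv σ.E τ.E)
  InI xS xT (ievA s)   = xS s × ∃[ a ] (σ.σ s ≡ inj₁ a)
  InI xS xT (ievB s t) = xS s × xT t × ∃[ b ] (σ.σ s ≡ inj₂ b × τ.σ t ≡ inj₁ b)
  InI xS xT (ievC t)   = xT t × ∃[ c ] (τ.σ t ≡ inj₂ c)

  Step : Sub σ.E → Sub τ.E → BRel (IEv σ.E τ.E)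
  Step xS xT e e' = InI xS xT e × InI xS xT e' ×
    ((∃[ s ] ∃[ s' ] (projS e ≡ just s × projS e' ≡ just s' × s σ.< s')) ⊎
     (∃[ t ] ∃[ t' ] (projT e ≡ just t × projT e' ≡ just t' × t τ.< t')))

  Causal : Sub σ.E → Sub τ.E → BRel (IEv σ.E τ.E)
  Causal xS xT = TransClosure (Step xS xT)

  IPos : IEv σ.E τ.E → Set
  IPos (ievA s)   = σ.pol s ≡ pos
  IPos (ievB s t) = ⊥
  IPos (ievC t)   = τ.pol t ≡ pos

  PlusCoveredInteraction : Sub σ.E → Sub τ.E → Set
  PlusCoveredInteraction xS xT =
    σ.IsConfig xS × τ.IsConfig xT ×
    projSB xS ≐ₛ projTB xT ×
    (∀ e → ¬ Causal xS xT e e) ×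
    (∀ e → InI xS xT e → (∀ e' → ¬ Causal xS xT e e') → IPos e)

  module _ (rA : Sub A.E) (rB : Sub B.E) (rC : Sub C.E) where

    JProp : Sub σ.E × Sub τ.E → Set₁
    JProp (xS , xT) = PlusCoveredInteraction xS xT ×
      (Σ[ θ ∈ BRel A.E ] (A.Sym⁻ θ × Bij θ (projSA xS) rA)) ×
      (Σ[ θ ∈ BRel B.E ] (B.Sym θ × Bij θ (projSB xS) rB)) ×
      (Σ[ θ ∈ BRel C.E ] (C.Sym⁺ θ × Bij θ (projTC xT) rC))

    JSet : Setoid (lsuc 0ℓ) 0ℓ
    JSet = On.setoid (SubSetoid σ.E ×ₛ SubSetoid τ.E) (proj₁ {B = JProp})

    ITriple : Set₁
    ITriple = Σ[ θA ∈ BRel A.E ] Σ[ xST ∈ Sub σ.E × Sub τ.E ] Σ[ θC ∈ BRel C.E ]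
      (PlusCoveredInteraction (proj₁ xST) (proj₂ xST) ×
       (Σ[ θ ∈ BRel B.E ] (B.Sym θ × Bij θ (projSB (proj₁ xST)) rB)) ×
       (A.Sym⁻ θA × Bij θA (projSA (proj₁ xST)) rA) ×
       (C.Sym⁺ θC × Bij θC (projTC (proj₂ xST)) rC))

    ISet : Setoid (lsuc 0ℓ) 0ℓ
    ISet = On.setoid (RelSetoid A.E ×ₛ ((SubSetoid σ.E ×ₛ SubSetoid τ.E) ×ₛ RelSetoid C.E))
      (λ (w : ITriple) → proj₁ w , proj₁ (proj₂ w) , proj₁ (proj₂ (proj₂ w)))

module Submission where

-- Both identities are instances of one counting argument.  A set W of triples
-- (θ⁻, x, θ⁺) projects onto a set K of configurations x (wit⁺_σ, resp. J_{τ⊛σ});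
-- the fibre over x is the set of pairs of symmetries θ⁻ : x_A ≅⁻ x̲_A and
-- θ⁺ : x_{B/C} ≅⁺ x̲_{B/C}.  Since x ∈ K comes with one such pair (θ₀⁻, θ₀⁺),
-- θ ↦ θ₀⁻¹ ⨾ θ identifies the isomorphisms x_A ≅⁻ x̲_A with Sym⁻(x̲_A) (likewise
-- for ⁺), so every fibre is in bijection with F = Sym⁻(x̲_A) × Sym⁺(x̲_{B/C}) and
-- |W| = |K| × |F|.

open import Defs

open import Level using (Level; _⊔_; 0ℓ) renaming (suc to lsuc)
open import Data.Nat using (ℕ; zero; suc)
open import Data.Nat.Properties using (*-zeroʳ; *-comm; *-assoc)
open import Data.Fin using (Fin)
open import Data.Fin.Properties using (*↔×)
open import Data.Product using (_×_; _,_; proj₁; proj₂; ∃-syntax)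
open import Data.Product.Relation.Binary.Pointwise.NonDependent using (_×ₛ_; Pointwise-≡↔≡)
open import Data.Product.Function.NonDependent.Setoid using (_×-inverse_)
open import Data.Sum using (inj₁; inj₂)
open import Data.Empty using (⊥; ⊥-elim)
open import Relation.Binary.PropositionalEquality as PE using (_≡_; refl; cong; sym; subst)
open import Relation.Binary.Bundles using (Setoid)
import Relation.Binary.Construct.On as On
open import Function.Bundles using (Inverse; Injection)
open import Function.Properties.Inverse using (Inverse⇒Injection)
import Function.Construct.Composition as Compose
import Function.Construct.Symmetry as Symmetry
import Function.Construct.Identity as Identity

*∞-zeroˡ : ∀ x → fin 0 *∞ x ≡ fin 0
*∞-zeroˡ (fin n) = refl
*∞-zeroˡ ∞       = refl

*∞-zeroʳ : ∀ x → x *∞ fin 0 ≡ fin 0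
*∞-zeroʳ (fin m) = cong fin (*-zeroʳ m)
*∞-zeroʳ ∞       = refl

*∞-comm : ∀ x y → x *∞ y ≡ y *∞ x
*∞-comm (fin m)       (fin n)       = cong fin (*-comm m n)
*∞-comm (fin zero)    ∞             = refl
*∞-comm (fin (suc m)) ∞             = refl
*∞-comm ∞             (fin zero)    = refl
*∞-comm ∞             (fin (suc n)) = refl
*∞-comm ∞             ∞             = refl

-- a zero factor absorbs everything; otherwise, with an infinite factor, both sides are ∞
*∞-assoc : ∀ x y z → (x *∞ y) *∞ z ≡ x *∞ (y *∞ z)
*∞-assoc (fin zero) y z = begin
  (fin 0 *∞ y) *∞ z  ≡⟨ cong (_*∞ z) (*∞-zeroˡ y) ⟩
  fin 0 *∞ z         ≡⟨ *∞-zeroˡ z ⟩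
  fin 0              ≡⟨ sym (*∞-zeroˡ (y *∞ z)) ⟩
  fin 0 *∞ (y *∞ z)  ∎
  where open PE.≡-Reasoning
*∞-assoc x (fin zero) z = begin
  (x *∞ fin 0) *∞ z  ≡⟨ cong (_*∞ z) (*∞-zeroʳ x) ⟩
  fin 0 *∞ z         ≡⟨ *∞-zeroˡ z ⟩
  fin 0              ≡⟨ sym (*∞-zeroʳ x) ⟩
  x *∞ fin 0         ≡⟨ cong (x *∞_) (sym (*∞-zeroˡ z)) ⟩
  x *∞ (fin 0 *∞ z)  ∎
  where open PE.≡-Reasoning
*∞-assoc x y (fin zero) = begin
  (x *∞ y) *∞ fin 0  ≡⟨ *∞-zeroʳ (x *∞ y) ⟩
  fin 0              ≡⟨ sym (*∞-zeroʳ x) ⟩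
  x *∞ fin 0         ≡⟨ cong (x *∞_) (sym (*∞-zeroʳ y)) ⟩
  x *∞ (y *∞ fin 0)  ∎
  where open PE.≡-Reasoning
*∞-assoc (fin (suc a)) (fin (suc b)) (fin (suc c)) = cong fin (*-assoc (suc a) (suc b) (suc c))
*∞-assoc (fin (suc a)) (fin (suc b)) ∞             = refl
*∞-assoc (fin (suc a)) ∞             (fin (suc c)) = refl
*∞-assoc (fin (suc a)) ∞             ∞             = refl
*∞-assoc ∞             (fin (suc b)) (fin (suc c)) = refl
*∞-assoc ∞             (fin (suc b)) ∞             = refl
*∞-assoc ∞             ∞             (fin (suc c)) = refl
*∞-assoc ∞             ∞             ∞             = refl

-- the rearrangement turning |K| × (|M| × |P|) into the order of the theorem
*∞-rotate : ∀ m k p → (m *∞ k) *∞ p ≡ k *∞ (m *∞ p)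
*∞-rotate m k p = PE.trans (cong (_*∞ p) (*∞-comm m k)) (*∞-assoc k m p)

module _ {c ℓ : Level} {X : Setoid c ℓ} where
  private module X = Setoid X

  card-empty : (X.Carrier → ⊥) → HasCard X (fin 0)
  card-empty none = record
    { to        = λ x → ⊥-elim (none x)
    ; from      = λ ()
    ; to-cong   = λ {x} _ → ⊥-elim (none x)
    ; from-cong = λ { {()} }
    ; inverse   = (λ { {()} }) , (λ {x} _ → ⊥-elim (none x)) }

  no-elements : HasCard X (fin 0) → X.Carrier → ⊥
  no-elements I x with Inverse.to I x
  ... | ()

  point : ∀ {n} → HasCard X (fin (suc n)) → X.Carrier
  point I = Inverse.from I Fin.zero

module _ {c ℓ c' ℓ' : Level} {X : Setoid c ℓ} {Y : Setoid c' ℓ'} where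
  private
    module X = Setoid X
    module Y = Setoid Y

  card-transport : ∀ {n} → Inverse X Y → HasCard Y n → HasCard X n
  card-transport {fin n} I J = Compose.inverse I J
  card-transport {∞}     I f = Compose.injection f (Inverse⇒Injection (Symmetry.inverse I))

  injection-×ˡ : Injection (PE.setoid ℕ) X → Y.Carrier → Injection (PE.setoid ℕ) (X ×ₛ Y)
  injection-×ˡ f y = record
    { to        = λ i → Injection.to f i , y
    ; cong      = λ { refl → X.refl , Y.refl }
    ; injective = λ eq → Injection.injective f (proj₁ eq) }

  injection-×ʳ : X.Carrier → Injection (PE.setoid ℕ) Y → Injection (PE.setoid ℕ) (X ×ₛ Y)
  injection-×ʳ x g = record
    { to        = λ i → x , Injection.to g i
    ; cong      = λ { refl → X.refl , Y.refl }
    ; injective = λ eq → Injection.injective g (proj₂ eq) }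

  card-× : ∀ {m n} → HasCard X m → HasCard Y n → HasCard (X ×ₛ Y) (m *∞ n)
  card-× {fin a} {fin b} I J =
    Compose.inverse (I ×-inverse J)
      (Compose.inverse Pointwise-≡↔≡ (Symmetry.inverse (*↔× {a} {b})))
  card-× {fin zero}    {∞}           I _ = card-empty (λ xy → no-elements I (proj₁ xy))
  card-× {fin (suc a)} {∞}           I g = injection-×ʳ (point I) g
  card-× {∞}           {fin zero}    _ J = card-empty (λ xy → no-elements J (proj₂ xy))
  card-× {∞}           {fin (suc b)} f J = injection-×ˡ f (point J)
  card-× {∞}           {∞}           f g = injection-×ˡ f (Injection.to g 0)

module Fibration {cw ℓw ck ℓk : Level} (W : Setoid cw ℓw) (K : Setoid ck ℓk)
                 (π : Setoid.Carrier W → Setoid.Carrier K)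
                 (π-cong : ∀ {w w'} → Setoid._≈_ W w w' → Setoid._≈_ K (π w) (π w')) where
  private
    module W = Setoid W
    module K = Setoid K

  Fibre : K.Carrier → Setoid (cw ⊔ ℓk) ℓw
  Fibre k = On.setoid W (proj₁ {B = λ w → π w K.≈ k})

  module _ {cf ℓf : Level} {F : Setoid cf ℓf} (triv : ∀ k → Inverse (Fibre k) F) where
    private module F = Setoid F

    section : K.Carrier → F.Carrier → W.Carrier
    section k z = proj₁ (Inverse.from (triv k) z)

    -- over a finite base the bijection with Fin n picks a representative of each
    -- class, which makes the fibre coordinates well defined: W ≅ Fin n × F
    trivialise : ∀ {n} → Inverse K (PE.setoid (Fin n)) → Inverse W (PE.setoid (Fin n) ×ₛ F)
    trivialise {n} Iᴷ = record
      { to        = λ w → Iᴷ.to (π w) , coord _ w (inClass w)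
      ; from      = λ (i , z) → section (Iᴷ.from i) z
      ; to-cong   = λ eq → Iᴷ.to-cong (π-cong eq) , coord-cong (Iᴷ.to-cong (π-cong eq)) eq
      ; from-cong = λ { {i , _} (refl , eq) → Φ.from-cong i eq }
      ; inverse   = invˡ , invʳ }
      where
        module Iᴷ = Inverse Iᴷ
        module Φ (i : Fin n) = Inverse (triv (Iᴷ.from i))

        inClass : ∀ w → π w K.≈ Iᴷ.from (Iᴷ.to (π w))
        inClass w = K.sym (Iᴷ.inverseʳ refl)

        coord : (i : Fin n) (w : W.Carrier) → π w K.≈ Iᴷ.from i → F.Carrier
        coord i w e = Φ.to i (w , e)

        coord-cong : ∀ {i i' w w'} {e : π w K.≈ Iᴷ.from i} {e' : π w' K.≈ Iᴷ.from i'} →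
                     i ≡ i' → w W.≈ w' → coord i w e F.≈ coord i' w' e'
        coord-cong {i} refl eq = Φ.to-cong i eq

        invˡ : ∀ {iz w} → w W.≈ section (Iᴷ.from (proj₁ iz)) (proj₂ iz) →
               (Iᴷ.to (π w) ≡ proj₁ iz) × (coord _ w (inClass w) F.≈ proj₂ iz)
        invˡ {i , z} {w} eq = sameClass , F.trans (coord-cong sameClass W.refl) (Φ.inverseˡ i {z} {w , e} eq)
          where
            e : π w K.≈ Iᴷ.from i
            e = K.trans (π-cong eq) (proj₂ (Φ.from i z))
            sameClass : Iᴷ.to (π w) ≡ i
            sameClass = Iᴷ.inverseˡ e

        invʳ : ∀ {w iz} → (proj₁ iz ≡ Iᴷ.to (π w)) × (proj₂ iz F.≈ coord _ w (inClass w)) →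
               section (Iᴷ.from (proj₁ iz)) (proj₂ iz) W.≈ w
        invʳ {w} {i , z} (refl , eq) = Φ.inverseʳ i {w , inClass w} eq

    lift : Injection (PE.setoid ℕ) K → F.Carrier → Injection (PE.setoid ℕ) W
    lift g z = record
      { to        = λ i → section (G.to i) z
      ; cong      = λ { refl → W.refl }
      ; injective = λ {i} {j} eq → G.injective
          (K.trans (K.sym (over i)) (K.trans (π-cong eq) (over j))) }
      where
        module G = Injection g
        over : ∀ i → π (section (G.to i) z) K.≈ G.to i
        over i = proj₂ (Inverse.from (triv (G.to i)) z)

    card-fibred : ∀ {k f} → HasCard K k → HasCard F f → HasCard W (k *∞ f)
    card-fibred {fin n}              Iᴷ hF = card-transport (trivialise Iᴷ)
                                               (card-× (Identity.inverse (PE.setoid (Fin n))) hF)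
    card-fibred {∞}    {fin zero}    _  hF =
      card-empty (λ w → no-elements hF (Inverse.to (triv (π w)) (w , K.refl)))
    card-fibred {∞}    {fin (suc _)} g  hF = lift g (point hF)
    card-fibred {∞}    {∞}           g  hF = lift g (Injection.to hF 0)

module _ {E : Set} where

  Bij-⨾ : ∀ {θ ψ : BRel E} {X Y Z} → Bij θ X Y → Bij ψ Y Z → Bij (θ ⨾ ψ) X Z
  Bij-⨾ {θ} {ψ} b c = record
    { dom = λ { (_ , p , _) → B.dom p }
    ; cod = λ { (_ , _ , q) → C.cod q }
    ; tot = λ x → let (y , p) = B.tot x ; (z , q) = C.tot (B.cod p) in z , y , p , q
    ; sur = λ z → let (y , q) = C.sur z ; (x , p) = B.sur (C.dom q) in x , y , p , q
    ; fun = λ { (y , p , q) (y' , p' , q') → C.fun q (subst (λ u → ψ u _) (sym (B.fun p p')) q') }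
    ; inj = λ { (y , p , q) (y' , p' , q') → B.inj p (subst (θ _) (C.inj q' q) p') } }
    where
      module B = Bij b
      module C = Bij c

  Bij-inv : ∀ {θ : BRel E} {X Y} → Bij θ X Y → Bij (invRel θ) Y X
  Bij-inv b = record
    { dom = B.cod ; cod = B.dom ; tot = B.sur ; sur = B.tot ; fun = B.inj ; inj = B.fun }
    where module B = Bij b

  Bij-resp-dom : ∀ {θ : BRel E} {X X' Y} → X ≐ₛ X' → Bij θ X Y → Bij θ X' Y
  Bij-resp-dom (f , g) b = record
    { dom = λ p → f (B.dom p) ; cod = B.cod ; tot = λ x → B.tot (g x) ; sur = B.sur
    ; fun = B.fun ; inj = B.inj }
    where module B = Bij b

  ⨾-congʳ : ∀ {θ ψ ψ' : BRel E} → ψ ≐ᵣ ψ' → (θ ⨾ ψ) ≐ᵣ (θ ⨾ ψ')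
  ⨾-congʳ (f , g) = (λ { (y , p , q) → y , p , f q }) , (λ { (y , p , q) → y , p , g q })

  ⨾-inv-cancel : ∀ {θ ψ : BRel E} {X Y Z} → Bij θ X Y → Bij ψ X Z → (θ ⨾ (invRel θ ⨾ ψ)) ≐ᵣ ψ
  ⨾-inv-cancel {θ} {ψ} b c =
      (λ { (y , p , x' , p' , q) → subst (λ u → ψ u _) (sym (B.inj p p')) q })
    , (λ {e} q → let (y , p) = B.tot (C.dom q) in y , p , e , p , q)
    where
      module B = Bij b
      module C = Bij c

  inv-⨾-cancel : ∀ {θ α : BRel E} {X Y Z} → Bij θ X Y → Bij α Y Z → (invRel θ ⨾ (θ ⨾ α)) ≐ᵣ α
  inv-⨾-cancel {θ} {α} b c =
      (λ { (x , p , y , p' , q) → subst (λ u → α u _) (sym (B.fun p p')) q })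
    , (λ {e} q → let (x , p) = B.sur (C.dom q) in x , p , e , p , q)
    where
      module B = Bij b
      module C = Bij c

  -- the part of the image of x lying over j respects extensional equality of x;
  -- this is how x ≐ x' transfers to x_A ≐ x'_A
  imageOver-cong : ∀ {S Y : Set} (h : S → E) (j : Y → E) {x x' : Sub S} → x ≐ₛ x' →
    (λ a → ∃[ s ] (x s × h s ≡ j a)) ≐ₛ (λ a → ∃[ s ] (x' s × h s ≡ j a))
  imageOver-cong h j (f , g) = (λ { (s , p , q) → s , f p , q }) , (λ { (s , p , q) → s , g p , q })

module IsoFamily (A : Game) {𝒮 : BRel (Game.E A) → Set} (fam : Game.IsIsoFam A 𝒮) where
  open Game.IsIsoFam A fam using (inverse; composition)
  private
    E = Game.E A
    module ≐ᵣ = Setoid (RelSetoid E)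

  Isos : Sub E → Sub E → Setoid (lsuc 0ℓ) 0ℓ
  Isos X Y = On.setoid (RelSetoid E) (proj₁ {B = λ θ → 𝒮 θ × Bij θ X Y})

  -- θ ↦ θ₀⁻¹ ⨾ θ is a bijection, with inverse α ↦ θ₀ ⨾ α; for Y = Z this identifies
  -- the isomorphisms X ≅ Y with the endo-isomorphisms of Y
  torsor : ∀ {θ₀ X Y Z} → 𝒮 θ₀ → Bij θ₀ X Y → Inverse (Isos X Z) (Isos Y Z)
  torsor {θ₀} s₀ b₀ = record
    { to        = λ (θ , s , b) → invRel θ₀ ⨾ θ
                                 , composition (inverse s₀) s (Bij-inv b₀) b , Bij-⨾ (Bij-inv b₀) b
    ; from      = λ (α , s , b) → θ₀ ⨾ α , composition s₀ s b₀ b , Bij-⨾ b₀ b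
    ; to-cong   = ⨾-congʳ
    ; from-cong = ⨾-congʳ
    ; inverse   = (λ { {α , _ , bα} eq → ≐ᵣ.trans (⨾-congʳ eq) (inv-⨾-cancel b₀ bα) })
                , (λ { {θ , _ , bθ} eq → ≐ᵣ.trans (⨾-congʳ eq) (⨾-inv-cancel b₀ bθ) }) }

module WitnessFibres {A B : Game} (tA : IsTCG A) (tB : IsTCG B) (σ : Strategy A B)
                     (rA : Sub (Game.E A)) (rB : Sub (Game.E B)) where
  open StratProj σ
  private
    module Neg = IsoFamily A (IsTCG.sym⁻IsoFam tA)
    module Pos = IsoFamily B (IsTCG.sym⁺IsoFam tB)
    module ≐ₛ = Setoid (SubSetoid (Strategy.E σ))

  underlying : Setoid.Carrier (WSet σ rA rB) → Setoid.Carrier (Wit σ rA rB)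
  underlying (θA , x , θB , (cf , pc) , wA , wB) = x , cf , pc , (θA , wA) , (θB , wB)

  open Fibration (WSet σ rA rB) (Wit σ rA rB) underlying (λ eq → proj₁ (proj₂ eq)) public

  fibre-isos : ∀ k → Inverse (Fibre k) (Neg.Isos (projA (proj₁ k)) rA ×ₛ Pos.Isos (projB (proj₁ k)) rB)
  fibre-isos (x , cf , pc , _ , _) = record
    { to        = λ { ((θA , _ , θB , _ , (sA , bA) , (sB , bB)) , ex) →
                      (θA , sA , Bij-resp-dom (imageOver-cong (Strategy.σ σ) inj₁ ex) bA)
                    , (θB , sB , Bij-resp-dom (imageOver-cong (Strategy.σ σ) inj₂ ex) bB) }
    ; from      = λ ((θA , wA) , (θB , wB)) → (θA , x , θB , (cf , pc) , wA , wB) , ≐ₛ.refl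
    ; to-cong   = λ (eA , _ , eB) → eA , eB
    ; from-cong = λ (eA , eB) → eA , ≐ₛ.refl , eB
    ; inverse   = (λ (eA , _ , eB) → eA , eB)
                , (λ { {_ , ex} (eA , eB) → eA , ≐ₛ.sym ex , eB }) }

  -- composing with the witnesses of x identifies each fibre with Sym⁻(x̲_A) × Sym⁺(x̲_B)
  trivialisation : ∀ k → Inverse (Fibre k) (SymMinus A rA ×ₛ SymPlus B rB)
  trivialisation k@(_ , _ , _ , (_ , sA , bA) , (_ , sB , bB)) =
    Compose.inverse (fibre-isos k) (Neg.torsor sA bA ×-inverse Pos.torsor sB bB)

module InteractionFibres {A B C : Game} (tA : IsTCG A) (tC : IsTCG C)
                         (σ : Strategy A B) (τ : Strategy B C)
                         (rA : Sub (Game.E A)) (rB : Sub (Game.E B)) (rC : Sub (Game.E C)) where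
  open Interaction σ τ
  private
    module Neg = IsoFamily A (IsTCG.sym⁻IsoFam tA)
    module Pos = IsoFamily C (IsTCG.sym⁺IsoFam tC)
    module ≐ₛˢ = Setoid (SubSetoid (Strategy.E σ))
    module ≐ₛᵗ = Setoid (SubSetoid (Strategy.E τ))

  underlying : Setoid.Carrier (ISet rA rB rC) → Setoid.Carrier (JSet rA rB rC)
  underlying (θA , xST , θC , pci , sB , wA , wC) = xST , pci , (θA , wA) , sB , (θC , wC)

  open Fibration (ISet rA rB rC) (JSet rA rB rC) underlying (λ eq → proj₁ (proj₂ eq)) public

  fibre-isos : ∀ k → Inverse (Fibre k)
    (Neg.Isos (projSA (proj₁ (proj₁ k))) rA ×ₛ Pos.Isos (projTC (proj₂ (proj₁ k))) rC)
  fibre-isos ((xS , xT) , pci , _ , sB , _) = record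
    { to        = λ { ((θA , _ , θC , _ , _ , (sA , bA) , (sC , bC)) , (eS , eT)) →
                      (θA , sA , Bij-resp-dom (imageOver-cong (Strategy.σ σ) inj₁ eS) bA)
                    , (θC , sC , Bij-resp-dom (imageOver-cong (Strategy.σ τ) inj₂ eT) bC) }
    ; from      = λ ((θA , wA) , (θC , wC)) →
                    (θA , (xS , xT) , θC , pci , sB , wA , wC) , (≐ₛˢ.refl , ≐ₛᵗ.refl)
    ; to-cong   = λ (eA , _ , eC) → eA , eC
    ; from-cong = λ (eA , eC) → eA , (≐ₛˢ.refl , ≐ₛᵗ.refl) , eC
    ; inverse   = (λ (eA , _ , eC) → eA , eC)
                , (λ { {_ , (eS , eT)} (eA , eC) → eA , (≐ₛˢ.sym eS , ≐ₛᵗ.sym eT) , eC }) }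

  -- composing with the witnesses identifies each fibre with Sym⁻(x̲_A) × Sym⁺(x̲_C)
  trivialisation : ∀ k → Inverse (Fibre k) (SymMinus A rA ×ₛ SymPlus C rC)
  trivialisation k@(_ , _ , (_ , sA , bA) , _ , (_ , sC , bC)) =
    Compose.inverse (fibre-isos k) (Neg.torsor sA bA ×-inverse Pos.torsor sC bC)

mainTheorem11 : (A B C : Game) → IsTCG A → IsTCG B → IsTCG C →
    (σ : Strategy A B) (τ : Strategy B C) →
    (rA : Sub (Game.E A)) (rB : Sub (Game.E B)) (rC : Sub (Game.E C)) →
    Game.IsConfig A rA → Game.IsConfig B rB → Game.IsConfig C rC →
    (∀ m w p → HasCard (SymMinus A rA) m → HasCard (Wit σ rA rB) w →
       HasCard (SymPlus B rB) p → HasCard (WSet σ rA rB) ((m *∞ w) *∞ p))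
    ×
    (∀ m j p → HasCard (SymMinus A rA) m → HasCard (Interaction.JSet σ τ rA rB rC) j →
       HasCard (SymPlus C rC) p → HasCard (Interaction.ISet σ τ rA rB rC) ((m *∞ j) *∞ p))
mainTheorem11 A B C tA tB tC σ τ rA rB rC _ _ _ =
    (λ m w p hM hWit hP → subst (HasCard (WSet σ rA rB)) (sym (*∞-rotate m w p))
                            (WF.card-fibred WF.trivialisation hWit (card-× hM hP)))
  , (λ m j p hM hJ hP → subst (HasCard (Interaction.ISet σ τ rA rB rC)) (sym (*∞-rotate m j p))
                          (IF.card-fibred IF.trivialisation hJ (card-× hM hP)))
  where
    module WF = WitnessFibres tA tB σ rA rB
    module IF = InteractionFibres tA tC σ τ rA rB rC
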